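{- Let $n\geq1$, $\pi\in S_n\setminus\{w_0^n\}$, let $i$ be the minimal index with $i+\pi(i)\leq n$, and let $\rho\in S_n$ with $\rho\gtrdot\pi$ in Bruhat order and $\rho(i)\neq\pi(i)$. If $D$ is a pipe dream for $\pi$, then for each $r=1,\dots,i$ the leftmost elbow tile in row $r$ of $D$ lies in column $\pi(r)$. If $D'$ is a pipe dream for $\rho$, then the same holds in rows $1,\dots,i-1$, while in row $i$ the leftmost elbow tile of $D'$ lies strictly to the right of column $\pi(i)$.
   Context: $w_0^n(r)=n+1-r$ for $r\leq n$. $\rho\gtrdot\pi$ means $\rho=\pi\circ(a\leftrightarrow b)$ with $\ell(\rho)=\ell(\pi)+1$. Squares are indexed by matrix coordinates $(a,b)$, $a,b\geq1$. A pipe dream is a filling of these squares with finitely many cross tiles and otherwise elbow tiles (an elbow tile joins its North edge to its West edge and its South edge to its East edge) such that no two pipes cross more than once; the pipe entering at the top of column $k$ is the $k$-pipe, and $D$ is a pipe dream for $w$ if the pipe exiting the left side in row $r$ is the $w(r)$-pipe for all $r$. -}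

module Defs where

open import Data.Nat using (ℕ; zero; suc; _+_; _≤_; _<_; _<?_)
open import Data.Fin as F using (Fin; toℕ; fromℕ<; opposite)
open import Data.Fin.Permutation using (Permutation′; _⟨$⟩ʳ_; transpose)
open import Data.List using (List; length; filter; cartesianProduct; allFin)
open import Data.List.Membership.Propositional using (_∈_; _∉_)
open import Data.Product using (_×_; _,_; ∃; Σ)
open import Relation.Binary.PropositionalEquality using (_≡_; _≢_)
open import Relation.Nullary using (¬_)
open import Relation.Nullary.Decidable using (_×-dec_)

-- The 1-indexed permutation w : ℕ → ℕ, extended by the identity beyond n
-- (the standard embedding S_n ⊂ S_∞); ext w 0 = 0 is junk.
ext : ∀ {n} → Permutation′ n → ℕ → ℕ
ext {n} w zero = zero
ext {n} w (suc m) with m <? n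
... | Relation.Nullary.yes p = suc (toℕ (w ⟨$⟩ʳ fromℕ< p))
... | Relation.Nullary.no _  = suc m

len : ∀ {n} → Permutation′ n → ℕ
len {n} w = length (filter (λ p → (Data.Product.proj₁ p F.<? Data.Product.proj₂ p)
                               ×-dec (w ⟨$⟩ʳ Data.Product.proj₂ p F.<? w ⟨$⟩ʳ Data.Product.proj₁ p))
                           (cartesianProduct (allFin n) (allFin n)))

-- w_0^n (r) = n + 1 - r ; in 0-indexed form this is Fin.opposite.
IsW0 : ∀ {n} → Permutation′ n → Set
IsW0 w = ∀ x → w ⟨$⟩ʳ x ≡ opposite x

_⋗_ : ∀ {n} → Permutation′ n → Permutation′ n → Set
_⋗_ {n} ρ π = Σ (Fin n) λ a → Σ (Fin n) λ b →
  (∀ x → ρ ⟨$⟩ʳ x ≡ π ⟨$⟩ʳ (transpose a b ⟨$⟩ʳ x)) × (len ρ ≡ suc (len π))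

-- Pipe dreams.
-- A filling is given by the finite list of squares (a , b) (matrix
-- coordinates, a , b ≥ 1) carrying a cross tile; all others are elbows.

Filling : Set
Filling = List (ℕ × ℕ)

data Dir : Set where
  fromN fromE : Dir

data State : Set where
  st : ℕ → ℕ → Dir → State   -- row, column, entry edge; column 0 = left boundary

-- D ⊢ s ↝ t : following a pipe from state s one reaches state t.
-- Cross: N → S, E → W.  Elbow: N → W, E → S.
data _⊢_↝_ (D : Filling) : State → State → Set where
  here   : ∀ {s} → D ⊢ s ↝ s
  crossN : ∀ {a b t} → (a , suc b) ∈ D → D ⊢ st (suc a) (suc b) fromN ↝ t → D ⊢ st a (suc b) fromN ↝ t
  elbowN : ∀ {a b t} → (a , suc b) ∉ D → D ⊢ st a b fromE ↝ t → D ⊢ st a (suc b) fromN ↝ t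
  crossE : ∀ {a b t} → (a , suc b) ∈ D → D ⊢ st a b fromE ↝ t → D ⊢ st a (suc b) fromE ↝ t
  elbowE : ∀ {a b t} → (a , suc b) ∉ D → D ⊢ st (suc a) (suc b) fromN ↝ t → D ⊢ st a (suc b) fromE ↝ t

ExitsAt : Filling → ℕ → ℕ → Set
ExitsAt D k r = D ⊢ st 1 k fromN ↝ st r 0 fromE

Visits : Filling → ℕ → ℕ → ℕ → Set
Visits D k a b = ∃ λ d → D ⊢ st 1 k fromN ↝ st a b d

-- No two (distinct) pipes cross more than once: two distinct pipes passing
-- through the same cross tile cross there.
Reduced : Filling → Set
Reduced D = ∀ j k → 1 ≤ j → 1 ≤ k → j ≢ k →
  ∀ a b a' b' → 1 ≤ a → 1 ≤ b → 1 ≤ a' → 1 ≤ b' →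
  (a , b) ∈ D → (a' , b') ∈ D →
  Visits D j a b → Visits D k a b → Visits D j a' b' → Visits D k a' b' →
  (a , b) ≡ (a' , b')

PipeDreamFor : Filling → (ℕ → ℕ) → Set
PipeDreamFor D w = Reduced D × (∀ r → 1 ≤ r → ExitsAt D (w r) r)

LeftmostElbow : Filling → ℕ → ℕ → Set
LeftmostElbow D r c = 1 ≤ c × (r , c) ∉ D × (∀ c' → 1 ≤ c' → c' < c → (r , c') ∈ D)

MinIndex : ∀ {n} → Permutation′ n → ℕ → Set
MinIndex {n} π i = 1 ≤ i × i ≤ n × i + ext π i ≤ n ×
  (∀ j → 1 ≤ j → j < i → ¬ (j + ext π j ≤ n))

-- Minimality of i forces π(r) = n + 1 − r for r < i, while i + π(i) ≤ n, so π decreases on rows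
-- 1, …, i.  In a pipe dream for a permutation w that decreases on rows 1, …, m, the leftmost elbow of
-- each such row r lies in column w(r): the w(r)-pipe leaves row r westwards, so row r has an elbow in
-- some column c ≤ w(r); the rows s above have their leftmost elbows in columns w(s) > w(r) ≥ c, so the
-- c-pipe falls straight down to the elbow (r, c) and exits in row r, i.e. c = w(r).
-- A Bruhat cover ρ = π ∘ (I J) with ρ(i) ≠ π(i) moves position I = i, and (I, J) is not an inversion
-- of π, since multiplying by an inversion does not increase the number of inversions.  As π decreases
-- up to i, this forces J > i and π(J) > π(i): ρ agrees with π above row i and ρ(i) > π(i).  If row i of
-- a pipe dream for ρ had its leftmost elbow in a column c ≤ π(i), the falling pipe would give ρ(i) = c.

module Submission where

open import Defs
open import Data.Nat as ℕ using (ℕ; zero; suc; _+_; _∸_; _≤_; _<_; z≤n; s≤s)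
open import Data.Nat.Properties
open import Data.Fin as Fin using (Fin; toℕ; fromℕ<)
import Data.Fin.Properties as Finₚ
import Data.Fin.Permutation.Components as PC
open import Data.Fin.Permutation using (Permutation′; _⟨$⟩ʳ_; _⟨$⟩ˡ_; inverseˡ; inverseʳ; transpose)
open import Data.List using (List; []; _∷_; length; filter; cartesianProduct; allFin)
open import Data.List.Properties using (length-removeAt′)
open import Data.List.Membership.Propositional using (_∈_; _∉_; _─_)
open import Data.List.Membership.Propositional.Properties
  using (∈-filter⁺; ∈-filter⁻; ∈-cartesianProduct⁺; ∈-allFin)
open import Data.List.Relation.Unary.Any using (here; there; index)
import Data.List.Relation.Unary.All as All
open import Data.List.Relation.Unary.AllPairs using (_∷_)
open import Data.List.Relation.Unary.Unique.Propositional using (Unique)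
import Data.List.Relation.Unary.Unique.Propositional.Properties as Uniqueₚ
open import Data.Product using (_×_; _,_; ∃; proj₁; proj₂)
open import Data.Sum using (_⊎_; inj₁; inj₂)
open import Data.Empty using (⊥-elim)
open import Induction.WellFounded using (Acc; acc)
open import Data.Nat.Induction using (<-wellFounded)
open import Relation.Binary using (tri<; tri≈; tri>)
open import Relation.Binary.PropositionalEquality
open import Relation.Nullary using (¬_; Dec; yes; no; contradiction)
open import Relation.Nullary.Decidable using (_×-dec_; dec-true; dec-false)
open import Relation.Unary using (Decidable)
open import Data.Product.Properties using (≡-dec)
open import Data.List.Membership.DecPropositional (≡-dec _≟_ _≟_) using (_∈?_)
open import Function using (_∘_)

∈-─ : ∀ {A : Set} {x y : A} {ys} (x∈ys : x ∈ ys) → y ∈ ys → y ≢ x → y ∈ ys ─ x∈ys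
∈-─ (here refl) (here refl) y≢x = ⊥-elim (y≢x refl)
∈-─ (here refl) (there y∈ys) _  = y∈ys
∈-─ (there _)   (here refl) _   = here refl
∈-─ (there x∈ys) (there y∈ys) y≢x = there (∈-─ x∈ys y∈ys y≢x)

module _ {A B : Set} where

  length-≤-injection : (f : A → B) {xs : List A} {ys : List B} → Unique xs →
    (∀ {x} → x ∈ xs → f x ∈ ys) →
    (∀ {x y} → x ∈ xs → y ∈ xs → f x ≡ f y → x ≡ y) →
    length xs ≤ length ys
  length-≤-injection f {[]} _ _ _ = z≤n
  length-≤-injection f {x ∷ xs} {ys} (x∉xs ∷ xs!) into inj = begin
    suc (length xs)           ≤⟨ s≤s (length-≤-injection f xs! into′ inj′) ⟩
    suc (length (ys ─ fx∈ys)) ≡⟨ length-removeAt′ ys (index fx∈ys) ⟨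
    length ys                 ∎
    where
    open ≤-Reasoning
    fx∈ys = into (here refl)
    into′ : ∀ {y} → y ∈ xs → f y ∈ ys ─ fx∈ys
    into′ y∈xs = ∈-─ fx∈ys (into (there y∈xs))
      (λ fy≡fx → All.lookup x∉xs y∈xs (sym (inj (there y∈xs) (here refl) fy≡fx)))
    inj′ : ∀ {y z} → y ∈ xs → z ∈ xs → f y ≡ f z → y ≡ z
    inj′ y∈xs z∈xs = inj (there y∈xs) (there z∈xs)

module _ {n : ℕ} where

  Inversion : Permutation′ n → Fin n × Fin n → Set
  Inversion w e = proj₁ e Fin.< proj₂ e × w ⟨$⟩ʳ proj₂ e Fin.< w ⟨$⟩ʳ proj₁ e

  inversion? : (w : Permutation′ n) → Decidable (Inversion w)
  inversion? w e = (proj₁ e Fin.<? proj₂ e) ×-dec (w ⟨$⟩ʳ proj₂ e Fin.<? w ⟨$⟩ʳ proj₁ e)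

  inversions : Permutation′ n → List (Fin n × Fin n)
  inversions w = filter (inversion? w) (cartesianProduct (allFin n) (allFin n))

  ∈-inversions⁺ : ∀ (w : Permutation′ n) {e} → Inversion w e → e ∈ inversions w
  ∈-inversions⁺ w = ∈-filter⁺ (inversion? w) (∈-cartesianProduct⁺ (∈-allFin _) (∈-allFin _))

  ∈-inversions⁻ : ∀ (w : Permutation′ n) {e} → e ∈ inversions w → Inversion w e
  ∈-inversions⁻ w e∈ =
    proj₂ (∈-filter⁻ (inversion? w) {xs = cartesianProduct (allFin n) (allFin n)} e∈)

  inversions-unique : (w : Permutation′ n) → Unique (inversions w)
  inversions-unique w = Uniqueₚ.filter⁺ (inversion? w)
    (Uniqueₚ.cartesianProduct⁺ (Uniqueₚ.allFin⁺ n) (Uniqueₚ.allFin⁺ n))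

module _ {n : ℕ} (p q : Fin n) where

  transpose-applyˡ : transpose p q ⟨$⟩ʳ p ≡ q
  transpose-applyˡ rewrite dec-true (p Finₚ.≟ p) refl = refl

  transpose-applyʳ : transpose p q ⟨$⟩ʳ q ≡ p
  transpose-applyʳ with q Finₚ.≟ p
  ... | yes q≡p = q≡p
  ... | no  _   rewrite dec-true (q Finₚ.≟ q) refl = refl

  transpose-fix : ∀ {x} → x ≢ p → x ≢ q → transpose p q ⟨$⟩ʳ x ≡ x
  transpose-fix {x} x≢p x≢q
    rewrite dec-false (x Finₚ.≟ p) x≢p | dec-false (x Finₚ.≟ q) x≢q = refl

module _ {n : ℕ} (p q : Fin n) where

  transpose-sym : ∀ x → transpose p q ⟨$⟩ʳ x ≡ transpose q p ⟨$⟩ʳ x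
  transpose-sym x = by-cases (x Finₚ.≟ p) (x Finₚ.≟ q)
    where
    by-cases : Dec (x ≡ p) → Dec (x ≡ q) → transpose p q ⟨$⟩ʳ x ≡ transpose q p ⟨$⟩ʳ x
    by-cases (yes refl) _          = trans (transpose-applyˡ p q) (sym (transpose-applyʳ q p))
    by-cases (no _)     (yes refl) = trans (transpose-applyʳ p q) (sym (transpose-applyˡ q p))
    by-cases (no x≢p)   (no x≢q)   =
      trans (transpose-fix p q x≢p x≢q) (sym (transpose-fix q p x≢q x≢p))

  transpose-involutive : ∀ x → transpose p q ⟨$⟩ʳ (transpose p q ⟨$⟩ʳ x) ≡ x
  transpose-involutive x =
    trans (cong (transpose p q ⟨$⟩ʳ_) (transpose-sym x)) (PC.transpose-inverse p q)

⟨$⟩ʳ-injective : ∀ {n} (w : Permutation′ n) {I J} → w ⟨$⟩ʳ I ≡ w ⟨$⟩ʳ J → I ≡ J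
⟨$⟩ʳ-injective w wI≡wJ = trans (sym (inverseˡ w)) (trans (cong (w ⟨$⟩ˡ_) wI≡wJ) (inverseˡ w))

module _ {n : ℕ} {w ρ : Permutation′ n} {p q : Fin n}
         (p<q : p Fin.< q) (wq<wp : w ⟨$⟩ʳ q Fin.< w ⟨$⟩ʳ p)
         (ρ≈wτ : ∀ x → ρ ⟨$⟩ʳ x ≡ w ⟨$⟩ʳ (transpose p q ⟨$⟩ʳ x)) where

  private
    τ : Fin n → Fin n
    τ x = transpose p q ⟨$⟩ʳ x

    data Reversed : Fin n → Fin n → Set where
      both  : Reversed p q
      left  : ∀ {y} → p Fin.< y → y ≢ q → Reversed p y
      right : ∀ {x} → x Fin.< q → x ≢ p → Reversed x q

    τ-monotone : ∀ {x y} → x Fin.< y → x ≢ p → y ≢ q → τ x Fin.< τ y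
    τ-monotone {x} {y} x<y x≢p y≢q = by-cases (y Finₚ.≟ p) (x Finₚ.≟ q)
      where
      by-cases : Dec (y ≡ p) → Dec (x ≡ q) → τ x Fin.< τ y
      by-cases (yes refl) _ =
        subst₂ Fin._<_ (sym (transpose-fix p q x≢p (Finₚ.<⇒≢ (<-trans x<y p<q))))
                       (sym (transpose-applyˡ p q)) (<-trans x<y p<q)
      by-cases (no y≢p) (yes refl) =
        subst₂ Fin._<_ (sym (transpose-applyʳ p q)) (sym (transpose-fix p q y≢p y≢q)) (<-trans p<q x<y)
      by-cases (no y≢p) (no x≢q) =
        subst₂ Fin._<_ (sym (transpose-fix p q x≢p x≢q)) (sym (transpose-fix p q y≢p y≢q)) x<y

    reversed : ∀ {x y} → x Fin.< y → ¬ (τ x Fin.< τ y) → Reversed x y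
    reversed {x} {y} x<y τx≮τy = by-cases (x Finₚ.≟ p) (y Finₚ.≟ q)
      where
      by-cases : Dec (x ≡ p) → Dec (y ≡ q) → Reversed x y
      by-cases (yes refl) (yes refl) = both
      by-cases (yes refl) (no y≢q)   = left x<y y≢q
      by-cases (no x≢p)   (yes refl) = right x<y x≢p
      by-cases (no x≢p)   (no y≢q)   = contradiction (τ-monotone x<y x≢p y≢q) τx≮τy

    τ-swap : ∀ {a b} → τ a ≡ b → τ b ≡ a
    τ-swap {a} refl = transpose-involutive p q a

    τ-injective : ∀ {a b} → τ a ≡ τ b → a ≡ b
    τ-injective τa≡τb = trans (sym (τ-swap τa≡τb)) (transpose-involutive p q _)

    τ-swap-< : ∀ {a b c d} → (τ a , τ b) ≡ (c , d) → a Fin.< b → τ c Fin.< τ d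
    τ-swap-< refl = subst₂ Fin._<_ (sym (transpose-involutive p q _)) (sym (transpose-involutive p q _))

    w-<-resp : ∀ {a a′ b b′} → a ≡ a′ → b ≡ b′ →
      w ⟨$⟩ʳ a Fin.< w ⟨$⟩ʳ b → w ⟨$⟩ʳ a′ Fin.< w ⟨$⟩ʳ b′
    w-<-resp refl refl wa<wb = wa<wb

    φ : Fin n × Fin n → Fin n × Fin n
    φ (x , y) with τ x Fin.<? τ y
    ... | yes _ = τ x , τ y
    ... | no  _ = x , y

    φ-inversion : ∀ {e} → Inversion ρ e → Inversion w (φ e)
    φ-inversion {x , y} (x<y , ρy<ρx) with τ x Fin.<? τ y
    ... | yes τx<τy = τx<τy , wτy<wτx
      where wτy<wτx = subst₂ Fin._<_ (ρ≈wτ y) (ρ≈wτ x) ρy<ρx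
    ... | no τx≮τy = x<y , wy<wx (reversed x<y τx≮τy) wτy<wτx
      where
      wτy<wτx = subst₂ Fin._<_ (ρ≈wτ y) (ρ≈wτ x) ρy<ρx
      wy<wx : ∀ {x y} → Reversed x y → w ⟨$⟩ʳ τ y Fin.< w ⟨$⟩ʳ τ x → w ⟨$⟩ʳ y Fin.< w ⟨$⟩ʳ x
      wy<wx both wp<wq =
        contradiction wq<wp (<-asym (w-<-resp (transpose-applyʳ p q) (transpose-applyˡ p q) wp<wq))
      wy<wx (left p<y y≢q) wy<wq = <-trans
        (w-<-resp (transpose-fix p q (≢-sym (Finₚ.<⇒≢ p<y)) y≢q) (transpose-applyˡ p q) wy<wq) wq<wp
      wy<wx (right x<q x≢p) wp<wx = <-trans wq<wp
        (w-<-resp (transpose-applyʳ p q) (transpose-fix p q x≢p (Finₚ.<⇒≢ x<q)) wp<wx)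

    φ-injective : ∀ {e e′} → Inversion ρ e → Inversion ρ e′ → φ e ≡ φ e′ → e ≡ e′
    φ-injective {x , y} {x′ , y′} (x<y , _) (x′<y′ , _) φe≡φe′
      with τ x Fin.<? τ y | τ x′ Fin.<? τ y′
    ... | yes _ | yes _ =
      cong₂ _,_ (τ-injective (cong proj₁ φe≡φe′)) (τ-injective (cong proj₂ φe≡φe′))
    ... | no _  | no _  = φe≡φe′
    ... | yes _ | no τx′≮τy′ = contradiction (τ-swap-< φe≡φe′ x<y) τx′≮τy′
    ... | no τx≮τy | yes _ = contradiction (τ-swap-< (sym φe≡φe′) x′<y′) τx≮τy

  len-∘transpose≤ : len ρ ≤ len w
  len-∘transpose≤ = length-≤-injection φ (inversions-unique ρ)
    (λ e∈ → ∈-inversions⁺ w (φ-inversion (∈-inversions⁻ ρ e∈)))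
    (λ e∈ e′∈ → φ-injective (∈-inversions⁻ ρ e∈) (∈-inversions⁻ ρ e′∈))

module _ {n : ℕ} {π ρ : Permutation′ n} where

  ⋗-moves : ρ ⋗ π → ∀ {I} → ρ ⟨$⟩ʳ I ≢ π ⟨$⟩ʳ I →
    ∃ λ J → J ≢ I × (∀ x → ρ ⟨$⟩ʳ x ≡ π ⟨$⟩ʳ (transpose I J ⟨$⟩ʳ x))
  ⋗-moves (a , b , ρ≈ , _) {I} ρI≢πI = by-cases (I Finₚ.≟ a) (I Finₚ.≟ b)
    where
    by-cases : Dec (I ≡ a) → Dec (I ≡ b) →
      ∃ λ J → J ≢ I × (∀ x → ρ ⟨$⟩ʳ x ≡ π ⟨$⟩ʳ (transpose I J ⟨$⟩ʳ x))
    by-cases (yes refl) _ = b , b≢I , ρ≈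
      where
      b≢I : b ≢ I
      b≢I refl = ρI≢πI (trans (ρ≈ I) (cong (π ⟨$⟩ʳ_) (transpose-applyˡ I I)))
    by-cases (no I≢a) (yes refl) = a , ≢-sym I≢a ,
      λ x → trans (ρ≈ x) (cong (π ⟨$⟩ʳ_) (transpose-sym a I x))
    by-cases (no I≢a) (no I≢b) =
      contradiction (trans (ρ≈ I) (cong (π ⟨$⟩ʳ_) (transpose-fix a b I≢a I≢b))) ρI≢πI

  ⋗-ascent : ∀ {p q} → len ρ ≡ suc (len π) →
    (∀ x → ρ ⟨$⟩ʳ x ≡ π ⟨$⟩ʳ (transpose p q ⟨$⟩ʳ x)) → p Fin.< q → ¬ (π ⟨$⟩ʳ q Fin.< π ⟨$⟩ʳ p)
  ⋗-ascent len≡ ρ≈ p<q πq<πp =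
    1+n≰n (subst (_≤ len π) len≡ (len-∘transpose≤ {w = π} {ρ = ρ} p<q πq<πp ρ≈))

  ⋗-first-move : ρ ⋗ π → ∀ {I} → ρ ⟨$⟩ʳ I ≢ π ⟨$⟩ʳ I →
    (∀ {J} → J Fin.< I → π ⟨$⟩ʳ I Fin.< π ⟨$⟩ʳ J) →
    (∀ {S} → S Fin.< I → ρ ⟨$⟩ʳ S ≡ π ⟨$⟩ʳ S) × π ⟨$⟩ʳ I Fin.< ρ ⟨$⟩ʳ I
  ⋗-first-move ρ⋗π@(_ , _ , _ , len≡) {I} ρI≢πI πI<earlier
    with ⋗-moves ρ⋗π ρI≢πI
  ... | J , J≢I , ρ≈πτ with Finₚ.<-cmp I J
  ...   | tri≈ _ I≡J _ = contradiction (sym I≡J) J≢I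
  ...   | tri> _ _ J<I = contradiction (πI<earlier J<I) (⋗-ascent len≡ ρ≈πτ′ J<I)
    where
    ρ≈πτ′ : ∀ x → ρ ⟨$⟩ʳ x ≡ π ⟨$⟩ʳ (transpose J I ⟨$⟩ʳ x)
    ρ≈πτ′ x = trans (ρ≈πτ x) (cong (π ⟨$⟩ʳ_) (transpose-sym I J x))
  ...   | tri< I<J _ _ = ρ≈π-before , subst (π ⟨$⟩ʳ I Fin.<_) (sym ρI≡πJ) πI<πJ
    where
    ρI≡πJ : ρ ⟨$⟩ʳ I ≡ π ⟨$⟩ʳ J
    ρI≡πJ = trans (ρ≈πτ I) (cong (π ⟨$⟩ʳ_) (transpose-applyˡ I J))
    πI<πJ : π ⟨$⟩ʳ I Fin.< π ⟨$⟩ʳ J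
    πI<πJ = Finₚ.≤∧≢⇒< (≮⇒≥ (⋗-ascent len≡ ρ≈πτ I<J)) (J≢I ∘ sym ∘ ⟨$⟩ʳ-injective π)
    ρ≈π-before : ∀ {S} → S Fin.< I → ρ ⟨$⟩ʳ S ≡ π ⟨$⟩ʳ S
    ρ≈π-before S<I = trans (ρ≈πτ _)
      (cong (π ⟨$⟩ʳ_) (transpose-fix I J (Finₚ.<⇒≢ S<I) (Finₚ.<⇒≢ (<-trans S<I I<J))))

data Position (n : ℕ) : ℕ → Set where
  inside : (I : Fin n) → Position n (suc (toℕ I))
  beyond : ∀ {r} → n < r → Position n r

position : ∀ {n} r → 1 ≤ r → Position n r
position {n} (suc m) _ with m ℕ.<? n
... | yes m<n = subst (Position n) (cong suc (Finₚ.toℕ-fromℕ< m<n)) (inside (fromℕ< m<n))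
... | no  m≮n = beyond (s≤s (≮⇒≥ m≮n))

module _ {n : ℕ} (w : Permutation′ n) where

  ext-inside : ∀ I → ext w (suc (toℕ I)) ≡ suc (toℕ (w ⟨$⟩ʳ I))
  ext-inside I with toℕ I ℕ.<? n
  ... | yes I<n = cong (λ J → suc (toℕ (w ⟨$⟩ʳ J))) (Finₚ.fromℕ<-toℕ I I<n)
  ... | no  I≮n = contradiction (Finₚ.toℕ<n I) I≮n

  ext-beyond : ∀ {r} → n < r → ext w r ≡ r
  ext-beyond {suc m} (s≤s n≤m) with m ℕ.<? n
  ... | yes m<n = contradiction n≤m (<⇒≱ m<n)
  ... | no  _   = refl

  ext-inside-≤ : ∀ I → ext w (suc (toℕ I)) ≤ n
  ext-inside-≤ I = subst (_≤ n) (sym (ext-inside I)) (Finₚ.toℕ<n (w ⟨$⟩ʳ I))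

  ext-≤ : ∀ {r} → 1 ≤ r → r ≤ n → ext w r ≤ n
  ext-≤ {r} 1≤r r≤n with position {n} r 1≤r
  ... | inside I = ext-inside-≤ I
  ... | beyond n<r = contradiction r≤n (<⇒≱ n<r)

  ext-injective : ∀ {r s} → 1 ≤ r → 1 ≤ s → ext w r ≡ ext w s → r ≡ s
  ext-injective {r} {s} 1≤r 1≤s wr≡ws with position {n} r 1≤r | position {n} s 1≤s
  ... | inside I | inside J = cong (suc ∘ toℕ) (⟨$⟩ʳ-injective w
          (Finₚ.toℕ-injective (suc-injective (trans (sym (ext-inside I)) (trans wr≡ws (ext-inside J))))))
  ... | inside I | beyond n<s =
          contradiction (subst (_≤ n) (trans wr≡ws (ext-beyond n<s)) (ext-inside-≤ I)) (<⇒≱ n<s)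
  ... | beyond n<r | inside J =
          contradiction (subst (_≤ n) (trans (sym wr≡ws) (ext-beyond n<r)) (ext-inside-≤ J)) (<⇒≱ n<r)
  ... | beyond n<r | beyond n<s = trans (sym (ext-beyond n<r)) (trans wr≡ws (ext-beyond n<s))

  ext-surjective : ∀ c → 1 ≤ c → ∃ λ s → 1 ≤ s × ext w s ≡ c
  ext-surjective c 1≤c with position {n} c 1≤c
  ... | inside C = suc (toℕ (w ⟨$⟩ˡ C)) , s≤s z≤n ,
          trans (ext-inside (w ⟨$⟩ˡ C)) (cong (suc ∘ toℕ) (inverseʳ w))
  ... | beyond n<c = c , 1≤c , ext-beyond n<c

module _ {n : ℕ} {π : Permutation′ n} {i : ℕ} (mi : MinIndex π i) where

  private
    i≤n = proj₁ (proj₂ mi)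
    i+πi≤n = proj₁ (proj₂ (proj₂ mi))
    minimal = proj₂ (proj₂ (proj₂ mi))

  -- If r + π(r) exceeded n + 1, then s = n + 1 − π(r) < r would satisfy s + π(s) = n + 1, so π(s) = π(r).
  agrees-with-w₀ : ∀ {r} → 1 ≤ r → r < i → r + ext π r ≡ suc n
  agrees-with-w₀ {r} = go (<-wellFounded r)
    where
    go : ∀ {r} → Acc _<_ r → 1 ≤ r → r < i → r + ext π r ≡ suc n
    go {r} (acc smaller) 1≤r r<i = ≤-antisym r+πr≤1+n (≰⇒> (minimal r 1≤r r<i))
      where
      r+πr≤1+n : r + ext π r ≤ suc n
      r+πr≤1+n with r + ext π r ≤? suc n
      ... | yes r+πr≤1+n = r+πr≤1+n
      ... | no  r+πr≰1+n = contradiction (ext-injective π 1≤s 1≤r πs≡πr) (<⇒≢ s<r)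
        where
        πr≤n : ext π r ≤ n
        πr≤n = ext-≤ π 1≤r (≤-trans (<⇒≤ r<i) i≤n)
        s = suc n ∸ ext π r
        s+πr≡1+n : s + ext π r ≡ suc n
        s+πr≡1+n = m∸n+n≡m (m≤n⇒m≤1+n πr≤n)
        1≤s : 1 ≤ s
        1≤s = m<n⇒0<n∸m (s≤s πr≤n)
        s<r : s < r
        s<r = +-cancelʳ-< (ext π r) s r (subst (_< r + ext π r) (sym s+πr≡1+n) (≰⇒> r+πr≰1+n))
        πs≡πr : ext π s ≡ ext π r
        πs≡πr = +-cancelˡ-≡ s _ _ (trans (go (smaller s<r) 1≤s (<-trans s<r r<i)) (sym s+πr≡1+n))

  row-sum-≤ : ∀ {r} → 1 ≤ r → r ≤ i → r + ext π r ≤ suc n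
  row-sum-≤ 1≤r r≤i with m≤n⇒m<n∨m≡n r≤i
  ... | inj₁ r<i  = ≤-reflexive (agrees-with-w₀ 1≤r r<i)
  ... | inj₂ refl = m≤n⇒m≤1+n i+πi≤n

  minIndex-decreasing : ∀ {s r} → 1 ≤ s → s < r → r ≤ i → ext π r < ext π s
  minIndex-decreasing {s} {r} 1≤s s<r r≤i = +-cancelˡ-< s (ext π r) (ext π s) (begin-strict
    s + ext π r <⟨ +-monoˡ-< (ext π r) s<r ⟩
    r + ext π r ≤⟨ row-sum-≤ (≤-trans 1≤s (<⇒≤ s<r)) r≤i ⟩
    suc n       ≡⟨ agrees-with-w₀ 1≤s (<-≤-trans s<r r≤i) ⟨
    s + ext π s ∎)
    where open ≤-Reasoning

columnSum : Filling → ℕ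
columnSum []            = 0
columnSum ((_ , b) ∷ D) = b + columnSum D

∈⇒column≤columnSum : ∀ {D a b} → (a , b) ∈ D → b ≤ columnSum D
∈⇒column≤columnSum {(_ , b) ∷ D} (here refl) = m≤m+n b (columnSum D)
∈⇒column≤columnSum {(_ , b) ∷ D} (there ab∈D) =
  ≤-trans (∈⇒column≤columnSum ab∈D) (m≤n+m (columnSum D) b)

row col : State → ℕ
row (st a _ _) = a
col (st _ b _) = b

data Above (r : ℕ) : State → Set where
  above : ∀ {a b d} → a < r → Above r (st a b d)
  top   : ∀ {b} → Above r (st r b fromN)

above-down : ∀ {a b r} → a < r → Above r (st (suc a) b fromN)
above-down a<r with m≤n⇒m<n∨m≡n a<r
... | inj₁ 1+a<r = above 1+a<r
... | inj₂ refl  = top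

entry-above : ∀ {r k} → 1 ≤ r → Above r (st 1 k fromN)
entry-above {suc zero}    _ = top
entry-above {suc (suc _)} _ = above (s≤s (s≤s z≤n))

module _ {D : Filling} where

  ↝-trans : ∀ {s t u} → D ⊢ s ↝ t → D ⊢ t ↝ u → D ⊢ s ↝ u
  ↝-trans here         t↝u = t↝u
  ↝-trans (crossN x p) t↝u = crossN x (↝-trans p t↝u)
  ↝-trans (elbowN x p) t↝u = elbowN x (↝-trans p t↝u)
  ↝-trans (crossE x p) t↝u = crossE x (↝-trans p t↝u)
  ↝-trans (elbowE x p) t↝u = elbowE x (↝-trans p t↝u)

  ↝-row-≤ : ∀ {s t} → D ⊢ s ↝ t → row s ≤ row t
  ↝-row-≤ here         = ≤-refl
  ↝-row-≤ (crossN _ p) = ≤-trans (n≤1+n _) (↝-row-≤ p)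
  ↝-row-≤ (elbowN _ p) = ↝-row-≤ p
  ↝-row-≤ (crossE _ p) = ↝-row-≤ p
  ↝-row-≤ (elbowE _ p) = ≤-trans (n≤1+n _) (↝-row-≤ p)

  ↝-comparable : ∀ {s t u} → D ⊢ s ↝ t → D ⊢ s ↝ u → D ⊢ t ↝ u ⊎ D ⊢ u ↝ t
  ↝-comparable here         s↝u          = inj₁ s↝u
  ↝-comparable s↝t          here         = inj₂ s↝t
  ↝-comparable (crossN _ p) (crossN _ q) = ↝-comparable p q
  ↝-comparable (crossN x _) (elbowN y _) = contradiction x y
  ↝-comparable (elbowN x _) (crossN y _) = contradiction y x
  ↝-comparable (elbowN _ p) (elbowN _ q) = ↝-comparable p q
  ↝-comparable (crossE _ p) (crossE _ q) = ↝-comparable p q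
  ↝-comparable (crossE x _) (elbowE y _) = contradiction x y
  ↝-comparable (elbowE x _) (crossE y _) = contradiction y x
  ↝-comparable (elbowE _ p) (elbowE _ q) = ↝-comparable p q

  boundary-↝ : ∀ {r t} → D ⊢ st r 0 fromE ↝ t → t ≡ st r 0 fromE
  boundary-↝ here = refl

  exit-row-unique : ∀ {k r r′} → ExitsAt D k r → ExitsAt D k r′ → r ≡ r′
  exit-row-unique p p′ with ↝-comparable p p′
  ... | inj₁ r↝r′ = cong row (sym (boundary-↝ r↝r′))
  ... | inj₂ r′↝r = cong row (boundary-↝ r′↝r)

  exit-meets-elbow : ∀ {s r} → D ⊢ s ↝ st r 0 fromE → Above r s →
    ∃ λ c → 1 ≤ c × c ≤ col s × (r , c) ∉ D
  exit-meets-elbow here (above r<r) = contradiction r<r (<-irrefl refl)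
  exit-meets-elbow (crossN _ p) (above a<r) = exit-meets-elbow p (above-down a<r)
  exit-meets-elbow (crossN _ p) top = contradiction (↝-row-≤ p) 1+n≰n
  exit-meets-elbow (elbowN _ p) (above a<r) with exit-meets-elbow p (above a<r)
  ... | c , 1≤c , c≤b , elbow = c , 1≤c , m≤n⇒m≤1+n c≤b , elbow
  exit-meets-elbow (elbowN elbow _) top = _ , s≤s z≤n , ≤-refl , elbow
  exit-meets-elbow (crossE _ p) (above a<r) with exit-meets-elbow p (above a<r)
  ... | c , 1≤c , c≤b , elbow = c , 1≤c , m≤n⇒m≤1+n c≤b , elbow
  exit-meets-elbow (elbowE _ p) (above a<r) = exit-meets-elbow p (above-down a<r)

  leftmostElbow-≤-pipe : ∀ {k r c} → ExitsAt D k r → 1 ≤ r → LeftmostElbow D r c → c ≤ k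
  leftmostElbow-≤-pipe exit 1≤r (_ , _ , crosses) with exit-meets-elbow exit (entry-above 1≤r)
  ... | c′ , 1≤c′ , c′≤k , elbow = ≤-trans (≮⇒≥ (λ c′<c → elbow (crosses c′ 1≤c′ c′<c))) c′≤k

  fall-through : ∀ {c} r → (∀ s → 1 ≤ s → s ≤ r → (s , suc c) ∈ D) →
    D ⊢ st 1 (suc c) fromN ↝ st (suc r) (suc c) fromN
  fall-through zero    _       = here
  fall-through (suc r) crosses = ↝-trans
    (fall-through r (λ s 1≤s s≤r → crosses s 1≤s (m≤n⇒m≤1+n s≤r)))
    (crossN (crosses (suc r) (s≤s z≤n) ≤-refl) here)

  slide-left : ∀ {r} b → (∀ c → 1 ≤ c → c ≤ b → (r , c) ∈ D) → D ⊢ st r b fromE ↝ st r 0 fromE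
  slide-left zero    _       = here
  slide-left (suc b) crosses = crossE (crosses (suc b) (s≤s z≤n) ≤-refl)
    (slide-left b (λ c 1≤c c≤b → crosses c 1≤c (m≤n⇒m≤1+n c≤b)))

  leftmostElbow-exit : ∀ {r c} → 1 ≤ r → LeftmostElbow D r c →
    (∀ s → 1 ≤ s → s < r → (s , c) ∈ D) → ExitsAt D c r
  leftmostElbow-exit {suc r} {suc c} _ (_ , elbow , crosses) column = ↝-trans
    (fall-through r (λ s 1≤s s≤r → column s 1≤s (s≤s s≤r)))
    (elbowN elbow (slide-left c (λ c′ 1≤c′ c′≤c → crosses c′ 1≤c′ (s≤s c′≤c))))

  leftmostElbow-exists : ∀ r → ∃ (LeftmostElbow D r)
  leftmostElbow-exists r = scan (columnSum D) 1 (s≤s z≤n) (λ { _ (s≤s _) (s≤s ()) })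
    (λ cross → 1+n≰n (∈⇒column≤columnSum cross))
    where
    scan : ∀ fuel c → 1 ≤ c → (∀ c′ → 1 ≤ c′ → c′ < c → (r , c′) ∈ D) → (r , c + fuel) ∉ D →
      ∃ (LeftmostElbow D r)
    scan fuel c 1≤c crosses last-elbow with (r , c) ∈? D
    ... | no elbow = c , 1≤c , elbow , crosses
    scan zero c _ _ last-elbow | yes cross =
      contradiction (subst (λ x → (r , x) ∈ D) (sym (+-identityʳ c)) cross) last-elbow
    scan (suc fuel) c _ crosses last-elbow | yes cross =
      scan fuel (suc c) (s≤s z≤n) crosses′ (subst (λ x → (r , x) ∉ D) (+-suc c fuel) last-elbow)
      where
      crosses′ : ∀ c′ → 1 ≤ c′ → c′ < suc c → (r , c′) ∈ D
      crosses′ c′ 1≤c′ c′<1+c with m≤n⇒m<n∨m≡n (ℕ.s≤s⁻¹ c′<1+c)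
      ... | inj₁ c′<c = crosses c′ 1≤c′ c′<c
      ... | inj₂ refl = cross

module _ {D : Filling} {w : ℕ → ℕ} (exits : ∀ r → 1 ≤ r → ExitsAt D (w r) r)
         (onto : ∀ c → 1 ≤ c → ∃ λ s → 1 ≤ s × w s ≡ c) where

  pipe-at-leftmostElbow : ∀ {r c} → 1 ≤ r → LeftmostElbow D r c →
    (∀ s → 1 ≤ s → s < r → (s , c) ∈ D) → w r ≡ c
  pipe-at-leftmostElbow {r} {c} 1≤r le column with onto c (proj₁ le)
  ... | s , 1≤s , refl = cong w (sym (exit-row-unique (exits s 1≤s) (leftmostElbow-exit 1≤r le column)))

  leftmostElbow-decreasing : ∀ {m} → (∀ {s r} → 1 ≤ s → s < r → r < m → w r < w s) →
    ∀ {r} → 1 ≤ r → r < m → LeftmostElbow D r (w r)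
  leftmostElbow-decreasing {m} decreasing {r} = go (<-wellFounded r)
    where
    go : ∀ {r} → Acc _<_ r → 1 ≤ r → r < m → LeftmostElbow D r (w r)
    go {r} (acc smaller) 1≤r r<m with leftmostElbow-exists r
    ... | c , le = subst (LeftmostElbow D r) (sym (pipe-at-leftmostElbow 1≤r le column)) le
      where
      column : ∀ s → 1 ≤ s → s < r → (s , c) ∈ D
      column s 1≤s s<r = proj₂ (proj₂ (go (smaller s<r) 1≤s (<-trans s<r r<m))) c (proj₁ le)
        (≤-<-trans (leftmostElbow-≤-pipe (exits r 1≤r) 1≤r le) (decreasing 1≤s s<r r<m))

  leftmostElbow-right-of : ∀ {r c b} → 1 ≤ r → LeftmostElbow D r c → b < w r →
    (∀ s → 1 ≤ s → s < r → ∀ c′ → 1 ≤ c′ → c′ ≤ b → (s , c′) ∈ D) → b < c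
  leftmostElbow-right-of {r} {c} {b} 1≤r le@(1≤c , _) b<wr crossed = ≰⇒> c≰b
    where
    c≰b : ¬ (c ≤ b)
    c≰b c≤b = <⇒≱ b<wr (subst (_≤ b) (sym wr≡c) c≤b)
      where
      wr≡c : w r ≡ c
      wr≡c = pipe-at-leftmostElbow 1≤r le (λ s 1≤s s<r → crossed s 1≤s s<r c 1≤c c≤b)

⋗-at-minIndex : ∀ {n} {π ρ : Permutation′ n} {i} → MinIndex π i → ρ ⋗ π → ext ρ i ≢ ext π i →
  (∀ {s} → 1 ≤ s → s < i → ext ρ s ≡ ext π s) × ext π i < ext ρ i
⋗-at-minIndex {n} {π} {ρ} mi@(1≤i , i≤n , _) ρ⋗π ρi≢πi with position {n} _ 1≤i
... | beyond n<i = contradiction i≤n (<⇒≱ n<i)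
... | inside I = agree , subst₂ _<_ (sym (ext-inside π I)) (sym (ext-inside ρ I)) (s≤s πI<ρI)
  where
  moved : ρ ⟨$⟩ʳ I ≢ π ⟨$⟩ʳ I
  moved ρI≡πI = ρi≢πi (trans (ext-inside ρ I) (trans (cong (suc ∘ toℕ) ρI≡πI) (sym (ext-inside π I))))
  earlier : ∀ {J} → J Fin.< I → π ⟨$⟩ʳ I Fin.< π ⟨$⟩ʳ J
  earlier {J} J<I = ℕ.s<s⁻¹ (subst₂ _<_ (ext-inside π I) (ext-inside π J)
    (minIndex-decreasing mi (s≤s z≤n) (s≤s J<I) ≤-refl))
  first-move = ⋗-first-move {π = π} {ρ = ρ} ρ⋗π moved earlier
  πI<ρI = proj₂ first-move
  agree : ∀ {s} → 1 ≤ s → s < suc (toℕ I) → ext ρ s ≡ ext π s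
  agree {s} 1≤s s<i with position {n} s 1≤s
  ... | inside S = trans (ext-inside ρ S)
          (trans (cong (suc ∘ toℕ) (proj₁ first-move (ℕ.s<s⁻¹ s<i))) (sym (ext-inside π S)))
  ... | beyond n<s = contradiction (<-≤-trans s<i i≤n) (<-asym n<s)

lemma3p2 : (n : ℕ) → 1 ≤ n → (π : Permutation′ n) → ¬ IsW0 π →
    (i : ℕ) → MinIndex π i →
    (ρ : Permutation′ n) → ρ ⋗ π → ext ρ i ≢ ext π i →
    (∀ D → PipeDreamFor D (ext π) →
      ∀ r → 1 ≤ r → r ≤ i → LeftmostElbow D r (ext π r))
    × (∀ D' → PipeDreamFor D' (ext ρ) →
      (∀ r → 1 ≤ r → r < i → LeftmostElbow D' r (ext π r))
      × ∃ λ c → LeftmostElbow D' i c × ext π i < c)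
-- 1 ≤ n and π ≠ w₀ only guarantee that i exists, which MinIndex π i already provides.
lemma3p2 n _ π _ i mi@(1≤i , _) ρ ρ⋗π ρi≢πi = π-rows , ρ-rows
  where
  ρ≈π-above = proj₁ (⋗-at-minIndex mi ρ⋗π ρi≢πi)
  πi<ρi = proj₂ (⋗-at-minIndex mi ρ⋗π ρi≢πi)

  ρ-decreasing : ∀ {s r} → 1 ≤ s → s < r → r < i → ext ρ r < ext ρ s
  ρ-decreasing 1≤s s<r r<i = subst₂ _<_ (sym (ρ≈π-above (≤-trans 1≤s (<⇒≤ s<r)) r<i))
    (sym (ρ≈π-above 1≤s (<-trans s<r r<i))) (minIndex-decreasing mi 1≤s s<r (<⇒≤ r<i))

  π-rows : ∀ D → PipeDreamFor D (ext π) → ∀ r → 1 ≤ r → r ≤ i → LeftmostElbow D r (ext π r)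
  π-rows D (_ , exits) r 1≤r r≤i = leftmostElbow-decreasing exits (ext-surjective π)
    (λ 1≤s s<r r<1+i → minIndex-decreasing mi 1≤s s<r (ℕ.s≤s⁻¹ r<1+i)) 1≤r (s≤s r≤i)

  ρ-rows : ∀ D → PipeDreamFor D (ext ρ) →
    (∀ r → 1 ≤ r → r < i → LeftmostElbow D r (ext π r)) × ∃ λ c → LeftmostElbow D i c × ext π i < c
  ρ-rows D (_ , exits) =
    rows , c , le , leftmostElbow-right-of exits (ext-surjective ρ) 1≤i le πi<ρi crossed
    where
    rows : ∀ r → 1 ≤ r → r < i → LeftmostElbow D r (ext π r)
    rows r 1≤r r<i = subst (LeftmostElbow D r) (ρ≈π-above 1≤r r<i)
      (leftmostElbow-decreasing exits (ext-surjective ρ) ρ-decreasing 1≤r r<i)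
    crossed : ∀ s → 1 ≤ s → s < i → ∀ c′ → 1 ≤ c′ → c′ ≤ ext π i → (s , c′) ∈ D
    crossed s 1≤s s<i c′ 1≤c′ c′≤πi = proj₂ (proj₂ (rows s 1≤s s<i)) c′ 1≤c′
      (≤-<-trans c′≤πi (minIndex-decreasing mi 1≤s s<i ≤-refl))
    c = proj₁ (leftmostElbow-exists {D} i)
    le = proj₂ (leftmostElbow-exists {D} i)
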